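{- If a finite bipartite graph $G$ contains an induced cycle of length at least $8$, then $G$ is not a cocomparability bigraph.
   Context: Let $(X,Y)$ be a bipartition of $G$. $G$ is a cocomparability bigraph if there exist linear orderings $\prec_X$ of $X$ and $\prec_Y$ of $Y$ such that for all $u,v\in X$, $w,z\in Y$ with $u\prec_X v$, $w\prec_Y z$ and $uz,vw\in E(G)$, at least one of $uw,vz$ is in $E(G)$. -}

module Defs where

open import Data.Nat using (ℕ; suc)
open import Data.Fin using (Fin; toℕ)
open import Data.Bool using (Bool; true; false)
open import Data.Sum using (_⊎_)
open import Data.Product using (_×_; Σ)
open import Relation.Binary.PropositionalEquality using (_≡_; _≢_)
open import Relation.Nullary using (¬_)
open import Function.Definitions using (Injective)
open import Level using (0ℓ)

record Graph (n : ℕ) : Set₁ where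
  field
    E     : Fin n → Fin n → Set
    sym   : ∀ {u v} → E u v → E v u
    irrefl : ∀ {u} → ¬ E u u
open Graph public

IsBipartition : ∀ {n} → Graph n → (Fin n → Bool) → Set
IsBipartition G side = ∀ {u v} → E G u v → side u ≢ side v

InX InY : ∀ {n} → (Fin n → Bool) → Fin n → Set
InX side v = side v ≡ true
InY side v = side v ≡ false

record LinearOrderOn {n : ℕ} (P : Fin n → Set) (R : Fin n → Fin n → Set) : Set where
  field
    irrefl : ∀ {x} → P x → ¬ R x x
    trans  : ∀ {x y z} → P x → P y → P z → R x y → R y z → R x z
    total  : ∀ {x y} → P x → P y → x ≢ y → R x y ⊎ R y x

CocomparabilityBigraph : ∀ {n} → Graph n → (Fin n → Bool) → Set₁
CocomparabilityBigraph {n} G side =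
  Σ (Fin n → Fin n → Set) λ ≺X →
  Σ (Fin n → Fin n → Set) λ ≺Y →
    LinearOrderOn (InX side) ≺X ×
    LinearOrderOn (InY side) ≺Y ×
    (∀ u v w z → InX side u → InX side v → InY side w → InY side z →
       ≺X u v → ≺Y w z → E G u z → E G v w → E G u w ⊎ E G v z)

CycSucc : ∀ {k} → Fin k → Fin k → Set
CycSucc {k} i j = (toℕ j ≡ suc (toℕ i)) ⊎ ((suc (toℕ i) ≡ k) × (toℕ j ≡ 0))

CycAdj : ∀ {k} → Fin k → Fin k → Set
CycAdj i j = CycSucc i j ⊎ CycSucc j i

InducedCycle : ∀ {n} → Graph n → ℕ → Set
InducedCycle {n} G k =
  Σ (Fin k → Fin n) λ c →
    Injective _≡_ _≡_ c ×
    (∀ i j → (E G (c i) (c j) → CycAdj i j) × (CycAdj i j → E G (c i) (c j)))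

module Submission where

-- Walk around the induced cycle forever, d 0, d 1, d 2, ... (indices
-- taken modulo the length k).  A cocomparability bigraph carries a strict
-- order ≺ on its vertices (≺X on X, ≺Y on Y) with the "crossing" property:
-- if ab and a'b' are edges, ab' and a'b are non-edges and a ≺ a', then
-- b ≺ b'.  On the cycle, a = d m, a' = d (4+m), b = d (1+m), b' = d (5+m)
-- fit this pattern once k ≥ 7, so an ordering of d 0 against d 4 propagates
-- around the cycle: d m ≺ d (4+m) for every m.  Chaining k such steps gives
-- d 0 ≺ d 4 ≺ d 8 ≺ ... ≺ d (4k) = d 0, contradicting irreflexivity.

open import Defs
open import Data.Nat using (ℕ; zero; suc; pred; _+_; _*_; _∸_; _≤_; _<_; z≤n; s≤s; _%_; NonZero; >-nonZero)
open import Data.Nat.Properties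
open import Data.Nat.DivMod
open import Data.Bool using (Bool; true; false; not)
open import Data.Bool.Properties using (¬-not; not-involutive)
open import Data.Fin using (Fin; toℕ; fromℕ<)
open import Data.Fin.Properties using (toℕ-fromℕ<; toℕ-injective; toℕ<n)
open import Data.Sum using (_⊎_; inj₁; inj₂; [_,_]; map)
open import Data.Product using (_×_; _,_; proj₁; proj₂)
open import Data.Empty using (⊥; ⊥-elim)
open import Function using (flip)
open import Relation.Nullary using (¬_; yes; no)
open import Relation.Binary.PropositionalEquality
  using (_≡_; _≢_; refl; trans; cong; subst; module ≡-Reasoning)
  renaming (sym to ≡-sym)

module CyclicPositions (k : ℕ) .{{_ : NonZero k}} where
  open ≡-Reasoning

  pos : ℕ → Fin k
  pos m = fromℕ< (m%n<n m k)

  toℕ-pos : ∀ m → toℕ (pos m) ≡ m % k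
  toℕ-pos m = toℕ-fromℕ< (m%n<n m k)

  %-absorbʳ-+ : ∀ a m → (a + m % k) % k ≡ (a + m) % k
  %-absorbʳ-+ a m = begin
    (a + m % k) % k           ≡⟨ %-distribˡ-+ a (m % k) k ⟩
    (a % k + m % k % k) % k   ≡⟨ cong (λ x → (a % k + x) % k) (m%n%n≡m%n m k) ⟩
    (a % k + m % k) % k       ≡⟨ ≡-sym (%-distribˡ-+ a m k) ⟩
    (a + m) % k               ∎

  shift-moves-remainder : ∀ {t r} → 0 < t → t < k → r < k → (t + r) % k ≢ r
  shift-moves-remainder {t} {r} 0<t t<k r<k eq with t + r <? k
  ... | yes t+r<k = <⇒≢ (m<n+m r 0<t) (≡-sym (trans (≡-sym (m<n⇒m%n≡m t+r<k)) eq))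
  ... | no t+r≮k = <⇒≢ t<k t≡k
    where
    k≤t+r : k ≤ t + r
    k≤t+r = ≮⇒≥ t+r≮k

    wrapped : t + r ∸ k + k ≡ t + r
    wrapped = m∸n+n≡m k≤t+r

    wrapped<k : t + r ∸ k < k
    wrapped<k = +-cancelʳ-< k _ k (subst (_< k + k) (≡-sym wrapped) (+-mono-< t<k r<k))

    wrapped≡r : t + r ∸ k ≡ r
    wrapped≡r = begin
      t + r ∸ k          ≡⟨ ≡-sym (m<n⇒m%n≡m wrapped<k) ⟩
      (t + r ∸ k) % k    ≡⟨ m≤n⇒[n∸m]%m≡n%m k≤t+r ⟩
      (t + r) % k        ≡⟨ eq ⟩
      r                  ∎

    t≡k : t ≡ k
    t≡k = +-cancelʳ-≡ r t k (begin
      t + r              ≡⟨ ≡-sym wrapped ⟩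
      t + r ∸ k + k      ≡⟨ cong (_+ k) wrapped≡r ⟩
      r + k              ≡⟨ +-comm r k ⟩
      k + r              ∎)

  shift-moves : ∀ {t} m → 0 < t → t < k → (t + m) % k ≢ m % k
  shift-moves {t} m 0<t t<k eq =
    shift-moves-remainder 0<t t<k (m%n<n m k) (trans (%-absorbʳ-+ t m) eq)

  pos-periodic : ∀ m → pos (k + m) ≡ pos m
  pos-periodic m = toℕ-injective (begin
    toℕ (pos (k + m))   ≡⟨ toℕ-pos (k + m) ⟩
    (k + m) % k         ≡⟨ cong (_% k) (+-comm k m) ⟩
    (m + k) % k         ≡⟨ [m+n]%n≡m%n m k ⟩
    m % k               ≡⟨ ≡-sym (toℕ-pos m) ⟩
    toℕ (pos m)         ∎)

  pos-distinct : ∀ {t} m → 0 < t → t < k → pos m ≢ pos (t + m)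
  pos-distinct m 0<t t<k eq =
    shift-moves m 0<t t<k (≡-sym (trans (≡-sym (toℕ-pos m)) (trans (cong toℕ eq) (toℕ-pos _))))

  cycSucc-% : ∀ {i j : Fin k} → CycSucc i j → toℕ j ≡ suc (toℕ i) % k
  cycSucc-% {j = j} (inj₁ j≡1+i) =
    trans j≡1+i (≡-sym (m<n⇒m%n≡m (subst (_< k) j≡1+i (toℕ<n j))))
  cycSucc-% (inj₂ (1+i≡k , j≡0)) = trans j≡0 (≡-sym (trans (cong (_% k) 1+i≡k) (n%n≡0 k)))

  cycSucc-pos : ∀ m {j} → CycSucc (pos m) j → toℕ j ≡ suc m % k
  cycSucc-pos m {j} succ = begin
    toℕ j                  ≡⟨ cycSucc-% succ ⟩
    suc (toℕ (pos m)) % k  ≡⟨ cong (λ x → suc x % k) (toℕ-pos m) ⟩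
    suc (m % k) % k        ≡⟨ %-absorbʳ-+ 1 m ⟩
    suc m % k              ∎

  pos-succ : ∀ m → CycSucc (pos m) (pos (suc m))
  pos-succ m with m≤n⇒m<n∨m≡n (m%n<n m k)
  ... | inj₁ 1+r<k = inj₁ (begin
    toℕ (pos (suc m))    ≡⟨ toℕ-pos (suc m) ⟩
    suc m % k            ≡⟨ ≡-sym (%-absorbʳ-+ 1 m) ⟩
    suc (m % k) % k      ≡⟨ m<n⇒m%n≡m 1+r<k ⟩
    suc (m % k)          ≡⟨ cong suc (≡-sym (toℕ-pos m)) ⟩
    suc (toℕ (pos m))    ∎)
  ... | inj₂ 1+r≡k = inj₂ (trans (cong suc (toℕ-pos m)) 1+r≡k , (begin
    toℕ (pos (suc m))    ≡⟨ toℕ-pos (suc m) ⟩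
    suc m % k            ≡⟨ ≡-sym (%-absorbʳ-+ 1 m) ⟩
    suc (m % k) % k      ≡⟨ cong (_% k) 1+r≡k ⟩
    k % k                ≡⟨ n%n≡0 k ⟩
    0                    ∎))

  pos-nonadjacent : ∀ t m → 2 ≤ t → t + 2 ≤ k → ¬ CycAdj (pos m) (pos (t + m))
  pos-nonadjacent (suc t) m (s≤s 1≤t) t+2≤k (inj₁ forward) =
    shift-moves (suc m) 1≤t (m+n≤o⇒m≤o (suc t) t+2≤k)
      (trans (cong (_% k) (+-suc t m))
        (trans (≡-sym (toℕ-pos (suc t + m))) (cycSucc-pos m forward)))
  pos-nonadjacent t m _ t+2≤k (inj₂ backward) =
    shift-moves m (s≤s z≤n) (≤-trans (≤-reflexive (+-comm 2 t)) t+2≤k)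
      (≡-sym (trans (≡-sym (toℕ-pos m)) (cycSucc-pos (t + m) backward)))

record PeriodicInducedWalk {n : ℕ} (G : Graph n) (k : ℕ) : Set where
  field
    vertex   : ℕ → Fin n
    periodic : ∀ m → vertex (k + m) ≡ vertex m
    edge     : ∀ m → E G (vertex m) (vertex (suc m))
    non-edge : ∀ t m → 2 ≤ t → t + 2 ≤ k → ¬ E G (vertex m) (vertex (t + m))
    distinct : ∀ t m → 0 < t → t < k → vertex m ≢ vertex (t + m)

induced-walk : ∀ {n} {G : Graph n} {k} .{{_ : NonZero k}} →
               InducedCycle G k → PeriodicInducedWalk G k
induced-walk {k = k} (c , c-injective , c-adjacency) = record
  { vertex   = λ m → c (pos m)
  ; periodic = λ m → cong c (pos-periodic m)
  ; edge     = λ m → proj₂ (c-adjacency _ _) (inj₁ (pos-succ m))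
  ; non-edge = λ t m 2≤t t+2≤k e → pos-nonadjacent t m 2≤t t+2≤k (proj₁ (c-adjacency _ _) e)
  ; distinct = λ t m 0<t t<k e → pos-distinct m 0<t t<k (c-injective e)
  }
  where open CyclicPositions k

Crossing : ∀ {n} → Graph n → (Fin n → Fin n → Set) → Set
Crossing G R = ∀ {a a' b b'} → E G a b → E G a' b' → ¬ E G a b' → ¬ E G a' b →
               b ≢ b' → R a a' → R b b'

-- The crossing configuration is symmetric under (a,b) ↔ (a',b').
crossing-flip : ∀ {n} {G : Graph n} {R} → Crossing G R → Crossing G (flip R)
crossing-flip cross ab a'b' ¬ab' ¬a'b b≢b' = cross a'b' ab ¬a'b ¬ab' (λ e → b≢b' (≡-sym e))

module CycleObstruction {n} {G : Graph n} {k} (W : PeriodicInducedWalk G k) (7≤k : 7 ≤ k)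
  {R : Fin n → Fin n → Set}
  (R-trans : ∀ {x y z} → R x y → R y z → R x z)
  (R-irrefl : ∀ {x} → ¬ R x x)
  (R-cross : Crossing G R) where
  open PeriodicInducedWalk W renaming (vertex to d)
  open ≡-Reasoning

  5≤k : 5 ≤ k
  5≤k = ≤-trans (m≤m+n 5 2) 7≤k

  propagate : ∀ m → R (d m) (d (4 + m)) → R (d (suc m)) (d (5 + m))
  propagate m = R-cross (edge m) (edge (4 + m))
    (non-edge 5 m (s≤s (s≤s z≤n)) 7≤k)
    (λ e → non-edge 3 (suc m) (s≤s (s≤s z≤n)) 5≤k (Graph.sym G e))
    (distinct 4 (suc m) (s≤s z≤n) 5≤k)

  all-steps : R (d 0) (d 4) → ∀ m → R (d m) (d (4 + m))
  all-steps r zero    = r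
  all-steps r (suc m) = propagate m (all-steps r m)

  chain : R (d 0) (d 4) → ∀ j → R (d 0) (d (suc j * 4))
  chain r zero    = r
  chain r (suc j) = R-trans (chain r j) (all-steps r (suc j * 4))

  d-multiple : ∀ j → d (j * k) ≡ d 0
  d-multiple zero    = refl
  d-multiple (suc j) = trans (periodic (j * k)) (d-multiple j)

  returns : d (suc (pred k) * 4) ≡ d 0
  returns = begin
    d (suc (pred k) * 4)  ≡⟨ cong (λ x → d (x * 4)) (suc-pred k {{>-nonZero (≤-trans (s≤s z≤n) 5≤k)}}) ⟩
    d (k * 4)             ≡⟨ cong d (*-comm k 4) ⟩
    d (4 * k)             ≡⟨ d-multiple 4 ⟩
    d 0                   ∎

  no-ordering : ¬ R (d 0) (d 4)
  no-ordering r = R-irrefl (subst (R (d 0)) returns (chain r (pred k)))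

module CocomparabilityOrder {n} (G : Graph n) (side : Fin n → Bool) (bip : IsBipartition G side)
  (≺X ≺Y : Fin n → Fin n → Set)
  (LX : LinearOrderOn (InX side) ≺X) (LY : LinearOrderOn (InY side) ≺Y)
  (cocomparable : ∀ u v w z → InX side u → InX side v → InY side w → InY side z →
                  ≺X u v → ≺Y w z → E G u z → E G v w → E G u w ⊎ E G v z) where

  _≺_ : Fin n → Fin n → Set
  x ≺ y = (InX side x × InX side y × ≺X x y) ⊎ (InY side x × InY side y × ≺Y x y)

  true≢false : true ≢ false
  true≢false ()

  ≺-irrefl : ∀ {x} → ¬ x ≺ x
  ≺-irrefl (inj₁ (x∈X , _ , r)) = LinearOrderOn.irrefl LX x∈X r
  ≺-irrefl (inj₂ (x∈Y , _ , r)) = LinearOrderOn.irrefl LY x∈Y r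

  ≺-trans : ∀ {x y z} → x ≺ y → y ≺ z → x ≺ z
  ≺-trans (inj₁ (x∈X , y∈X , r)) (inj₁ (_ , z∈X , s)) = inj₁ (x∈X , z∈X , LinearOrderOn.trans LX x∈X y∈X z∈X r s)
  ≺-trans (inj₂ (x∈Y , y∈Y , r)) (inj₂ (_ , z∈Y , s)) = inj₂ (x∈Y , z∈Y , LinearOrderOn.trans LY x∈Y y∈Y z∈Y r s)
  ≺-trans (inj₁ (_ , y∈X , _)) (inj₂ (y∈Y , _ , _)) = ⊥-elim (true≢false (trans (≡-sym y∈X) y∈Y))
  ≺-trans (inj₂ (_ , y∈Y , _)) (inj₁ (y∈X , _ , _)) = ⊥-elim (true≢false (trans (≡-sym y∈X) y∈Y))

  ≺-total : ∀ {x y} → side x ≡ side y → x ≢ y → x ≺ y ⊎ y ≺ x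
  ≺-total {x} {y} same x≢y with side x in x-side
  ... | true  = map (λ r → inj₁ (refl , ≡-sym same , r)) (λ r → inj₁ (≡-sym same , refl , r))
                    (LinearOrderOn.total LX x-side (≡-sym same) x≢y)
  ... | false = map (λ r → inj₂ (refl , ≡-sym same , r)) (λ r → inj₂ (≡-sym same , refl , r))
                    (LinearOrderOn.total LY x-side (≡-sym same) x≢y)

  across : ∀ {u v} → E G u v → side v ≡ not (side u)
  across e = ¬-not (λ eq → bip e (≡-sym eq))

  X-to-Y : ∀ {u v} → InX side u → E G u v → InY side v
  X-to-Y u∈X e = trans (across e) (cong not u∈X)

  Y-to-X : ∀ {u v} → InY side u → E G u v → InX side v
  Y-to-X u∈Y e = trans (across e) (cong not u∈Y)

  crossing-X : ∀ {a a' b b'} → InX side a → InX side a' → E G a b → E G a' b' →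
               ¬ E G a b' → ¬ E G a' b → b ≢ b' → ≺X a a' → ≺Y b b'
  crossing-X {a} {a'} {b} {b'} a∈X a'∈X ab a'b' ¬ab' ¬a'b b≢b' r
    with LinearOrderOn.total LY (X-to-Y a∈X ab) (X-to-Y a'∈X a'b') b≢b'
  ... | inj₁ s = s
  ... | inj₂ s with cocomparable a a' b' b a∈X a'∈X (X-to-Y a'∈X a'b') (X-to-Y a∈X ab) r s ab a'b'
  ...   | inj₁ e = ⊥-elim (¬ab' e)
  ...   | inj₂ e = ⊥-elim (¬a'b e)

  crossing-Y : ∀ {a a' b b'} → InY side a → InY side a' → E G a b → E G a' b' →
               ¬ E G a b' → ¬ E G a' b → b ≢ b' → ≺Y a a' → ≺X b b'
  crossing-Y {a} {a'} {b} {b'} a∈Y a'∈Y ab a'b' ¬ab' ¬a'b b≢b' r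
    with LinearOrderOn.total LX (Y-to-X a∈Y ab) (Y-to-X a'∈Y a'b') b≢b'
  ... | inj₁ s = s
  ... | inj₂ s with cocomparable b' b a a' (Y-to-X a'∈Y a'b') (Y-to-X a∈Y ab) a∈Y a'∈Y s r
                      (Graph.sym G a'b') (Graph.sym G ab)
  ...   | inj₁ e = ⊥-elim (¬ab' (Graph.sym G e))
  ...   | inj₂ e = ⊥-elim (¬a'b (Graph.sym G e))

  ≺-crossing : Crossing G _≺_
  ≺-crossing ab a'b' ¬ab' ¬a'b b≢b' (inj₁ (a∈X , a'∈X , r)) =
    inj₂ (X-to-Y a∈X ab , X-to-Y a'∈X a'b' , crossing-X a∈X a'∈X ab a'b' ¬ab' ¬a'b b≢b' r)
  ≺-crossing ab a'b' ¬ab' ¬a'b b≢b' (inj₂ (a∈Y , a'∈Y , r)) =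
    inj₁ (Y-to-X a∈Y ab , Y-to-X a'∈Y a'b' , crossing-Y a∈Y a'∈Y ab a'b' ¬ab' ¬a'b b≢b' r)

  side-two-steps : ∀ {u v w} → E G u v → E G v w → side w ≡ side u
  side-two-steps uv vw = trans (across vw) (trans (cong not (across uv)) (not-involutive _))

  -- d 0 and d 4 lie on one side, so ≺ compares them; either way the
  -- comparison cannot be propagated around the cycle.
  no-long-induced-walk : ∀ {k} → PeriodicInducedWalk G k → 7 ≤ k → ⊥
  no-long-induced-walk W 7≤k =
    [ CycleObstruction.no-ordering W 7≤k ≺-trans ≺-irrefl ≺-crossing
    , CycleObstruction.no-ordering W 7≤k (flip ≺-trans) ≺-irrefl (crossing-flip {G = G} ≺-crossing)
    ] (≺-total same-side (distinct 4 0 (s≤s z≤n) (≤-trans (m≤m+n 5 2) 7≤k)))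
    where
    open PeriodicInducedWalk W
    same-side : side (vertex 0) ≡ side (vertex 4)
    same-side = ≡-sym (trans (side-two-steps (edge 2) (edge 3)) (side-two-steps (edge 0) (edge 1)))

corollary4p4 : (n : ℕ) (G : Graph n) (side : Fin n → Bool) →
               IsBipartition G side →
               (k : ℕ) → 8 ≤ k → InducedCycle G k →
               ¬ CocomparabilityBigraph G side
corollary4p4 n G side bip (suc _) 8≤k cycle (≺X , ≺Y , LX , LY , cocomparable) =
  no-long-induced-walk (induced-walk cycle) (≤-trans (n≤1+n 7) 8≤k)
  where open CocomparabilityOrder G side bip ≺X ≺Y LX LY cocomparable
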